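{- Let $q$ be a prime power, $k,s$ integers, and let $\mathcal{L}$ be a set of points of the projective space $\mathrm{PG}(k-1,q)$, viewed as $1$-dimensional vector subspaces (lines through the origin) of $\mathbb{F}_q^k$. Then $\mathcal{L}$ is a strong $(s-1)$-blocking set if and only if the set $B=\bigcup_{\ell\in\mathcal{L}} \ell \subseteq \mathbb{F}_q^k$ is an affine $s$-blocking set.
   Context: $\mathrm{PG}(k-1,q)$ is the projective space whose points, lines, ..., hyperplanes are the $1$-, $2$-, ..., $(k-1)$-dimensional vector subspaces of $\mathbb{F}_q^k$; the codimension of a projective subspace equals the codimension of the corresponding vector subspace. A set of points of $\mathrm{PG}(k-1,q)$ is a strong $t$-blocking set if it intersects every codimension-$t$ subspace in a set of points that spans that subspace. An affine $s$-blocking set in $\mathbb{F}_q^k$ is a set of points of $\mathbb{F}_q^k$ meeting every affine subspace of codimension $s$ (i.e., every coset of a $(k-s)$-dimensional vector subspace). -}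

module Defs where

open import Level using (Level; _⊔_; suc)
open import Algebra.Bundles using (CommutativeRing)
open import Data.Nat using (ℕ; _^_) renaming (suc to sucℕ; _+_ to _+ℕ_)
open import Data.Nat.Primality using (Prime)
open import Data.Fin using (Fin)
import Data.Fin

open import Data.Product using (Σ; ∃; _×_; _,_)
open import Relation.Binary.PropositionalEquality using (_≡_)
open import Relation.Nullary using (¬_)

record Field (c ℓ : Level) : Set (suc (c ⊔ ℓ)) where
  field
    commRing : CommutativeRing c ℓ
  open CommutativeRing commRing public
  field
    0≉1     : ¬ (0# ≈ 1#)
    inverse : ∀ x → ¬ (x ≈ 0#) → ∃ λ y → (x * y) ≈ 1#

record HasSize {c ℓ} (F : Field c ℓ) (q : ℕ) : Set (c ⊔ ℓ) where
  open Field F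
  field
    enum      : Fin q → Carrier
    enum-inj  : ∀ i j → enum i ≈ enum j → i ≡ j
    enum-surj : ∀ x → ∃ λ i → enum i ≈ x

PrimePower : ℕ → Set
PrimePower q = ∃ λ p → ∃ λ n → Prime p × q ≡ p ^ sucℕ n

module LinAlg {c ℓ} (F : Field c ℓ) where
  open Field F

  V : ℕ → Set c
  V k = Fin k → Carrier

  _≈v_ : ∀ {k} → V k → V k → Set ℓ
  u ≈v w = ∀ i → u i ≈ w i

  0v : ∀ {k} → V k
  0v i = 0#

  _+v_ : ∀ {k} → V k → V k → V k
  (u +v w) i = u i + w i

  _·v_ : ∀ {k} → Carrier → V k → V k
  (a ·v u) i = a * u i

  linComb : ∀ {k d} → (Fin d → V k) → (Fin d → Carrier) → V k
  linComb {d = 0} b cs = 0v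
  linComb {d = sucℕ d} b cs =
    (cs Data.Fin.zero ·v b Data.Fin.zero) +v linComb (λ j → b (Data.Fin.suc j)) (λ j → cs (Data.Fin.suc j))

  LinIndep : ∀ {k d} → (Fin d → V k) → Set (c ⊔ ℓ)
  LinIndep b = ∀ cs → linComb b cs ≈v 0v → ∀ j → cs j ≈ 0#

  InSpan : ∀ {k d} → (Fin d → V k) → V k → Set (c ⊔ ℓ)
  InSpan b x = ∃ λ cs → x ≈v linComb b cs

  InSpanOf : ∀ {k ℓ'} → (V k → Set ℓ') → V k → Set (c ⊔ ℓ ⊔ ℓ')
  InSpanOf {k} S x = ∃ λ (m : ℕ) → Σ (Fin m → V k) λ u → (∀ j → S (u j)) × InSpan u x

  -- A set of points of PG(k-1,q) is given by a predicate P on F^k whose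
  -- elements are nonzero: the point set is { ⟨v⟩ : P v }.
  NonzeroPts : ∀ {k ℓ'} → (V k → Set ℓ') → Set (c ⊔ ℓ ⊔ ℓ')
  NonzeroPts P = ∀ v → P v → ¬ (v ≈v 0v)

  UnionOfPts : ∀ {k ℓ'} → (V k → Set ℓ') → V k → Set (c ⊔ ℓ ⊔ ℓ')
  UnionOfPts P x = ∃ λ v → P v × ∃ λ a → x ≈v (a ·v v)

  -- Strong t-blocking set: for every vector subspace W of codimension t
  -- (W = span of a linearly independent family b of d vectors, d + t = k),
  -- the points of the set lying in W span W.
  StrongBlocking : ∀ {k ℓ'} → ℕ → (V k → Set ℓ') → Set (c ⊔ ℓ ⊔ ℓ')
  StrongBlocking {k} t P =
    ∀ (d : ℕ) → d +ℕ t ≡ k → (b : Fin d → V k) → LinIndep b →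
      ∀ x → InSpan b x → InSpanOf (λ v → P v × InSpan b v) x

  AffineBlocking : ∀ {k ℓ'} → ℕ → (V k → Set ℓ') → Set (c ⊔ ℓ ⊔ ℓ')
  AffineBlocking {k} s B =
    ∀ (d : ℕ) → d +ℕ s ≡ k → (b : Fin d → V k) → LinIndep b → (a : V k) →
      ∃ λ x → B x × ∃ λ cs → x ≈v (a +v linComb b cs)

-- (⇒) Let W have codimension s and a ∉ W. Then W + ⟨a⟩ has codimension s − 1, so a is a
-- combination of points of the set lying in W + ⟨a⟩; one of them has a nonzero a-coordinate,
-- and rescaling it gives a point of B in a + W. If a ∈ W, the point 0 of B works (the set is
-- nonempty, since it spans a nonzero subspace).
-- (⇐) Let W have codimension s − 1, with basis b, and let U be the set of coordinate vectors
-- (with respect to b) of the span of the points of the set lying in W. Every point of B in W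
-- lies in that span, so U meets every affine hyperplane of F^d; and a subspace meeting every
-- affine hyperplane is the whole space.
-- Finiteness of F makes equality and membership in a span decidable, which is what the
-- case distinctions need constructively.
module Submission where

open import Defs
open import Level using (Level; _⊔_)
open import Data.Nat using (ℕ; _≤_; _∸_)
open import Data.Product using (_×_)
open import Function.Bundles using (_⇔_)

open import Data.Nat using (zero; suc; s≤s; z≤n) renaming (_+_ to _+ℕ_)
import Data.Nat.Properties as ℕₚ
open import Data.Fin using (Fin; zero; suc; _↑ʳ_; _≟_)
import Data.Fin.Properties as Finₚ
open import Data.Vec.Functional using (_∷_; head; tail)
open import Data.Product using (Σ; ∃; _,_; proj₁; proj₂)
open import Data.Empty using (⊥-elim)
open import Function using (_∘_)
open import Function.Bundles using (mk⇔)
open import Relation.Nullary using (¬_; Dec; yes; no)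
open import Relation.Nullary.Decidable using (map′)
import Relation.Binary.PropositionalEquality as ≡

module LinearAlgebra {c ℓ} (F : Field c ℓ) where
  open Field F hiding (zero)
  open LinAlg F
  open import Algebra.Properties.CommutativeSemigroup +-commutativeSemigroup using (interchange)
  open import Algebra.Properties.Ring ring using (-1*x≈-x)

  private
    variable
      ℓ' : Level
      k d m : ℕ

  ≈v-sym : {x y : V k} → x ≈v y → y ≈v x
  ≈v-sym e i = sym (e i)

  ≈v-trans : {x y z : V k} → x ≈v y → y ≈v z → x ≈v z
  ≈v-trans e e' i = trans (e i) (e' i)

  x+y+[-1]y≈x : ∀ x y → (x + y) + (- 1#) * y ≈ x
  x+y+[-1]y≈x x y = trans (+-cong refl (-1*x≈-x y))
                 (trans (+-assoc x y (- y)) (trans (+-cong refl (-‿inverseʳ y)) (+-identityʳ x)))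

  x+[-1]x≈0 : ∀ x → x + (- 1#) * x ≈ 0#
  x+[-1]x≈0 x = trans (+-cong (sym (+-identityˡ x)) refl) (x+y+[-1]y≈x 0# x)

  inverse-cancel : ∀ {a β} → a * β ≈ 1# → ∀ x → β * (a * x) ≈ x
  inverse-cancel {a} {β} aβ≈1 x =
    trans (sym (*-assoc β a x)) (trans (*-cong (trans (*-comm β a) aβ≈1) refl) (*-identityˡ x))

  inverse-x+y+[-1]y≈x : ∀ {a β} → a * β ≈ 1# → ∀ x y → β * (a * x + y) ≈ x + β * y
  inverse-x+y+[-1]y≈x {a} {β} aβ≈1 x y = trans (distribˡ β (a * x) y) (+-cong (inverse-cancel aβ≈1 x) refl)

  linComb-congʳ : (b : Fin d → V k) {cs cs' : V d} → cs ≈v cs' → linComb b cs ≈v linComb b cs'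
  linComb-congʳ {d = zero} b e i = refl
  linComb-congʳ {d = suc d} b e i = +-cong (*-cong (e zero) refl) (linComb-congʳ (tail b) (e ∘ suc) i)

  linComb-congˡ : {b b' : Fin d → V k} → (∀ j → b j ≈v b' j) → ∀ cs → linComb b cs ≈v linComb b' cs
  linComb-congˡ {d = zero} e cs i = refl
  linComb-congˡ {d = suc d} e cs i = +-cong (*-cong refl (e zero i)) (linComb-congˡ (e ∘ suc) (tail cs) i)

  linComb-0v : (b : Fin d → V k) → linComb b 0v ≈v 0v
  linComb-0v {d = zero} b i = refl
  linComb-0v {d = suc d} b i = trans (+-cong (zeroˡ _) (linComb-0v (tail b) i)) (+-identityˡ 0#)

  linComb-+v : (b : Fin d → V k) (cs cs' : V d) → linComb b (cs +v cs') ≈v (linComb b cs +v linComb b cs')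
  linComb-+v {d = zero} b cs cs' i = sym (+-identityˡ 0#)
  linComb-+v {d = suc d} b cs cs' i =
    trans (+-cong (distribʳ _ _ _) (linComb-+v (tail b) (tail cs) (tail cs') i)) (interchange _ _ _ _)

  linComb-·v : (b : Fin d → V k) (a : Carrier) (cs : V d) → linComb b (a ·v cs) ≈v (a ·v linComb b cs)
  linComb-·v {d = zero} b a cs i = sym (zeroʳ a)
  linComb-·v {d = suc d} b a cs i =
    trans (+-cong (*-assoc _ _ _) (linComb-·v (tail b) a (tail cs) i)) (sym (distribˡ a _ _))

  linComb-linComb : (b : Fin d → V k) (h : Fin m → V d) (cs : V m) →
    linComb b (linComb h cs) ≈v linComb (λ j → linComb b (h j)) cs
  linComb-linComb {m = zero} b h cs = linComb-0v b
  linComb-linComb {m = suc m} b h cs i =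
    trans (linComb-+v b _ _ i)
          (+-cong (linComb-·v b (head cs) (head h) i) (linComb-linComb b (tail h) (tail cs) i))

  tail-linComb : (u : Fin d → V (suc k)) (cs : V d) → tail (linComb u cs) ≈v linComb (λ j → tail (u j)) cs
  tail-linComb {d = zero} u cs i = refl
  tail-linComb {d = suc d} u cs i = +-cong refl (tail-linComb (tail u) (tail cs) i)

  head-linComb-of-heads≈0 : {u : Fin d → V (suc k)} → (∀ j → head (u j) ≈ 0#) → ∀ cs → head (linComb u cs) ≈ 0#
  head-linComb-of-heads≈0 {d = zero} u≈0 cs = refl
  head-linComb-of-heads≈0 {d = suc d} u≈0 cs =
    trans (+-cong (trans (*-cong refl (u≈0 zero)) (zeroʳ _)) (head-linComb-of-heads≈0 (u≈0 ∘ suc) (tail cs))) (+-identityˡ 0#)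

  linComb-head-coeff≈0 : (u : Fin (suc d) → V k) (cs : V (suc d)) → head cs ≈ 0# →
    linComb u cs ≈v linComb (tail u) (tail cs)
  linComb-head-coeff≈0 u cs c≈0 i = trans (+-cong (trans (*-cong c≈0 refl) (zeroˡ _)) refl) (+-identityˡ _)

  inverse-·v-linComb : (u : Fin (suc d) → V k) (cs : V (suc d)) {β : Carrier} → head cs * β ≈ 1# →
    (β ·v linComb u cs) ≈v (head u +v linComb (tail u) (β ·v tail cs))
  inverse-·v-linComb u cs cβ≈1 i =
    trans (inverse-x+y+[-1]y≈x cβ≈1 _ _) (+-cong refl (sym (linComb-·v (tail u) _ (tail cs) i)))

  LinIndep-congˡ : {u w : Fin d → V k} → (∀ j → u j ≈v w j) → LinIndep u → LinIndep w
  LinIndep-congˡ u≈w u-indep cs z = u-indep cs (≈v-trans (linComb-congˡ u≈w cs) z)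

  LinIndep-tail : {u : Fin (suc d) → V k} → LinIndep u → LinIndep (tail u)
  LinIndep-tail {u = u} u-indep cs z j =
    u-indep (0# ∷ cs) (≈v-trans (linComb-head-coeff≈0 u (0# ∷ cs) refl) z) (suc j)

  LinIndep-∘↑ʳ : ∀ t {u : Fin (t +ℕ d) → V k} → LinIndep u → LinIndep (u ∘ (t ↑ʳ_))
  LinIndep-∘↑ʳ zero u-indep = u-indep
  LinIndep-∘↑ʳ (suc t) {u} u-indep = LinIndep-∘↑ʳ t {tail u} (LinIndep-tail {u = u} u-indep)

  LinIndep-of-tails : {u : Fin d → V (suc k)} → LinIndep (λ j → tail (u j)) → LinIndep u
  LinIndep-of-tails tails-indep cs z = tails-indep cs (λ i → trans (sym (tail-linComb _ cs i)) (z (suc i)))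

  LinIndep-linComb : {b : Fin d → V k} {h : Fin m → V d} → LinIndep b → LinIndep h →
    LinIndep (λ j → linComb b (h j))
  LinIndep-linComb {b = b} {h} b-indep h-indep cs z =
    h-indep cs (b-indep (linComb h cs) (≈v-trans (linComb-linComb b h cs) z))

  e₀ : V (suc k)
  e₀ = 1# ∷ 0v

  prependE₀ : (Fin d → V k) → Fin (suc d) → V (suc k)
  prependE₀ h = e₀ ∷ λ j → 0# ∷ h j

  head-linComb-prependE₀ : (h : Fin d → V k) (cs : V (suc d)) → head (linComb (prependE₀ h) cs) ≈ head cs
  head-linComb-prependE₀ h cs =
    trans (+-cong (*-identityʳ _) (head-linComb-of-heads≈0 (λ j → refl) (tail cs))) (+-identityʳ _)

  tail-linComb-prependE₀ : (h : Fin d → V k) (cs : V (suc d)) →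
    tail (linComb (prependE₀ h) cs) ≈v linComb h (tail cs)
  tail-linComb-prependE₀ h cs i =
    trans (+-cong (zeroʳ _) (tail-linComb (λ j → 0# ∷ h j) (tail cs) i)) (+-identityˡ _)

  LinIndep-prependE₀ : {h : Fin d → V k} → LinIndep h → LinIndep (prependE₀ h)
  LinIndep-prependE₀ {h = h} h-indep cs z zero = trans (sym (head-linComb-prependE₀ h cs)) (z zero)
  LinIndep-prependE₀ {h = h} h-indep cs z (suc j) =
    h-indep (tail cs) (λ i → trans (sym (tail-linComb-prependE₀ h cs i)) (z (suc i))) j

  stdBasis : Fin k → V k
  stdBasis {k = zero} = λ ()
  stdBasis {k = suc k} = prependE₀ stdBasis

  stdBasis-diag : (j : Fin k) → stdBasis j j ≈ 1#
  stdBasis-diag zero = refl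
  stdBasis-diag (suc j) = stdBasis-diag j

  stdBasis-indep : LinIndep (stdBasis {k})
  stdBasis-indep {k = zero} cs z ()
  stdBasis-indep {k = suc k} = LinIndep-prependE₀ stdBasis-indep

  record IsSubspace {k ℓ'} (U : V k → Set ℓ') : Set (c ⊔ ℓ ⊔ ℓ') where
    field
      resp      : ∀ {x y} → x ≈v y → U x → U y
      0v∈       : U 0v
      +v-closed : ∀ {x y} → U x → U y → U (x +v y)
      ·v-closed : ∀ a {x} → U x → U (a ·v x)

    linComb-closed : (u : Fin m → V k) → (∀ j → U (u j)) → ∀ cs → U (linComb u cs)
    linComb-closed {m = zero} u u∈ cs = 0v∈
    linComb-closed {m = suc m} u u∈ cs =
      +v-closed (·v-closed (head cs) (u∈ zero)) (linComb-closed (tail u) (u∈ ∘ suc) (tail cs))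

  InSpan-isSubspace : (b : Fin d → V k) → IsSubspace (InSpan b)
  InSpan-isSubspace b = record
    { resp      = λ { x≈y (cs , x≈) → cs , ≈v-trans (≈v-sym x≈y) x≈ }
    ; 0v∈       = 0v , ≈v-sym (linComb-0v b)
    ; +v-closed = λ { (cs , x≈) (cs' , y≈) →
        cs +v cs' , λ i → trans (+-cong (x≈ i) (y≈ i)) (sym (linComb-+v b cs cs' i)) }
    ; ·v-closed = λ { a (cs , x≈) → a ·v cs , λ i → trans (*-cong refl (x≈ i)) (sym (linComb-·v b a cs i)) }
    }

  InSpan-member : (b : Fin d → V k) (j : Fin d) → InSpan b (b j)
  InSpan-member b zero =
    e₀ , λ i → sym (trans (+-cong (*-identityˡ _) (linComb-0v (tail b) i)) (+-identityʳ _))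
  InSpan-member b (suc j) with InSpan-member (tail b) j
  ... | cs , bj≈ = 0# ∷ cs , ≈v-trans bj≈ (≈v-sym (linComb-head-coeff≈0 b (0# ∷ cs) refl))

  module _ {k ℓ'} (S : V k → Set ℓ') where

    InSpanOf-single : ∀ {v} → S v → InSpanOf S v
    InSpanOf-single {v} v∈S =
      1 , (λ _ → v) , (λ _ → v∈S) , (λ _ → 1#) , λ i → sym (trans (+-identityʳ _) (*-identityˡ _))

    InSpanOf-∷ : ∀ {w x} a → S w → InSpanOf S x → InSpanOf S ((a ·v w) +v x)
    InSpanOf-∷ a w∈S (m , u , u∈S , cs , x≈) =
      suc m , _ ∷ u , (λ { zero → w∈S ; (suc j) → u∈S j }) , a ∷ cs , λ i → +-cong refl (x≈ i)

    InSpanOf-linComb-+v : ∀ {y} (u : Fin m → V k) → (∀ j → S (u j)) → ∀ cs →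
      InSpanOf S y → InSpanOf S (linComb u cs +v y)
    InSpanOf-linComb-+v {m = zero} {y} u u∈S cs (n , w , w∈S , ds , y≈) =
      n , w , w∈S , ds , λ i → trans (+-identityˡ _) (y≈ i)
    InSpanOf-linComb-+v {m = suc m} u u∈S cs y∈ with
      InSpanOf-∷ (head cs) (u∈S zero) (InSpanOf-linComb-+v (tail u) (u∈S ∘ suc) (tail cs) y∈)
    ... | n , w , w∈S , ds , ≈w = n , w , w∈S , ds , λ i → trans (+-assoc _ _ _) (≈w i)

    InSpanOf-isSubspace : IsSubspace (InSpanOf S)
    InSpanOf-isSubspace = record
      { resp      = λ { x≈y (m , u , u∈S , cs , x≈) → m , u , u∈S , cs , ≈v-trans (≈v-sym x≈y) x≈ }
      ; 0v∈       = 0 , (λ ()) , (λ ()) , 0v , λ i → refl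
      ; +v-closed = λ { (m , u , u∈S , cs , x≈) y∈ →
          let m' , w , w∈S , ds , ≈w = InSpanOf-linComb-+v u u∈S cs y∈
          in m' , w , w∈S , ds , λ i → trans (+-cong (x≈ i) refl) (≈w i) }
      ; ·v-closed = λ { a (m , u , u∈S , cs , x≈) →
          m , u , u∈S , a ·v cs , λ i → trans (*-cong refl (x≈ i)) (sym (linComb-·v u a cs i)) }
      }

    InSpanOf-inhabited : ∀ {x} → InSpanOf S x → ¬ (x ≈v 0v) → Σ (V k) S
    InSpanOf-inhabited (zero , u , u∈S , cs , x≈) x≉0 = ⊥-elim (x≉0 x≈)
    InSpanOf-inhabited (suc m , u , u∈S , cs , x≈) x≉0 = u zero , u∈S zero

  IsSubspace-linComb⁻¹ : (b : Fin d → V k) {U : V k → Set ℓ'} → IsSubspace U →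
    IsSubspace (λ cs → U (linComb b cs))
  IsSubspace-linComb⁻¹ b sub = record
    { resp      = λ e → resp (linComb-congʳ b e)
    ; 0v∈       = resp (≈v-sym (linComb-0v b)) 0v∈
    ; +v-closed = λ x∈ y∈ → resp (≈v-sym (linComb-+v b _ _)) (+v-closed x∈ y∈)
    ; ·v-closed = λ a x∈ → resp (≈v-sym (linComb-·v b a _)) (·v-closed a x∈)
    }
    where open IsSubspace sub

  TailImage : (V (suc k) → Set ℓ') → V k → Set (c ⊔ ℓ ⊔ ℓ')
  TailImage U y = ∃ λ x → U x × tail x ≈v y

  IsSubspace-TailImage : {U : V (suc k) → Set ℓ'} → IsSubspace U → IsSubspace (TailImage U)
  IsSubspace-TailImage sub = record
    { resp      = λ { e (x , x∈ , x≈) → x , x∈ , ≈v-trans x≈ e }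
    ; 0v∈       = 0v , 0v∈ , λ i → refl
    ; +v-closed = λ { (x , x∈ , x≈) (y , y∈ , y≈) → x +v y , +v-closed x∈ y∈ , λ i → +-cong (x≈ i) (y≈ i) }
    ; ·v-closed = λ { a (x , x∈ , x≈) → a ·v x , ·v-closed a x∈ , λ i → *-cong refl (x≈ i) }
    }
    where open IsSubspace sub

  -- Forgetting the first coordinate maps U onto a subspace that again meets
  -- every affine hyperplane, hence onto everything. Lifting the standard basis of F^k into U
  -- gives k independent vectors, and the translate by e₀ of their span meets U, so e₀ ∈ U.
  affineBlocking-subspace⇒full : {U : V k → Set ℓ'} → IsSubspace U → AffineBlocking 1 U → ∀ x → U x
  affineBlocking-subspace⇒full {k = zero} sub meets x = resp (λ ()) 0v∈
    where open IsSubspace sub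
  affineBlocking-subspace⇒full {k = suc k} {U = U} sub meets x =
    resp decompose (+v-closed (lifted∈U (tail x)) (·v-closed _ e₀∈U))
    where
    open IsSubspace sub

    tailMeets : AffineBlocking 1 (TailImage U)
    tailMeets d eq h h-indep a
      with meets (suc d) (≡.cong suc eq) (prependE₀ h) (LinIndep-prependE₀ h-indep) (0# ∷ a)
    ... | y , y∈ , cs , y≈ =
      tail y , (y , y∈ , λ i → refl) , tail cs ,
      λ i → trans (y≈ (suc i)) (+-cong refl (tail-linComb-prependE₀ h cs i))

    lift : ∀ y → TailImage U y
    lift = affineBlocking-subspace⇒full (IsSubspace-TailImage sub) tailMeets

    lifted : V k → V (suc k)
    lifted y = proj₁ (lift y)

    lifted∈U : ∀ y → U (lifted y)
    lifted∈U y = proj₁ (proj₂ (lift y))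

    tail-lifted : ∀ y → tail (lifted y) ≈v y
    tail-lifted y = proj₂ (proj₂ (lift y))

    basisLift-indep : LinIndep (lifted ∘ stdBasis)
    basisLift-indep = LinIndep-of-tails (LinIndep-congˡ (λ j → ≈v-sym (tail-lifted (stdBasis j))) stdBasis-indep)

    e₀∈U : U e₀
    e₀∈U with meets k (ℕₚ.+-comm k 1) (lifted ∘ stdBasis) basisLift-indep e₀
    ... | y , y∈ , cs , y≈ =
      resp (λ i → trans (+-cong (y≈ i) refl) (x+y+[-1]y≈x _ _))
           (+v-closed y∈ (·v-closed (- 1#) (linComb-closed (lifted ∘ stdBasis) (lifted∈U ∘ stdBasis) cs)))

    z : V (suc k)
    z = lifted (tail x)

    decompose : (z +v ((head x + - head z) ·v e₀)) ≈v x
    decompose zero =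
      trans (+-cong refl (*-identityʳ _))
        (trans (+-comm _ _) (trans (+-assoc _ _ _) (trans (+-cong refl (-‿inverseˡ _)) (+-identityʳ _))))
    decompose (suc i) =
      trans (+-cong refl (zeroʳ _)) (trans (+-identityʳ _) (tail-lifted (tail x) i))

  StrongBlocking-inhabited : ∀ {t} (P : V k → Set ℓ') d → suc d +ℕ t ≡.≡ k → StrongBlocking t P → Σ (V k) P
  StrongBlocking-inhabited {t = t} P d eq blocking with ≡.trans (ℕₚ.+-comm t (suc d)) eq
  ... | ≡.refl = proj₁ w , proj₁ (proj₂ w)
    where
    u : Fin (suc d) → V (t +ℕ suc d)
    u = stdBasis ∘ (t ↑ʳ_)

    u₀≉0 : ¬ (u zero ≈v 0v)
    u₀≉0 u₀≈0 = 0≉1 (trans (sym (u₀≈0 (t ↑ʳ zero))) (stdBasis-diag (t ↑ʳ zero)))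

    w : Σ (V (t +ℕ suc d)) (λ v → P v × InSpan u v)
    w = InSpanOf-inhabited _
          (blocking (suc d) (ℕₚ.+-comm (suc d) t) u (LinIndep-∘↑ʳ t stdBasis-indep) (u zero) (InSpan-member u zero))
          u₀≉0

module FiniteField {c ℓ} (F : Field c ℓ) {q : ℕ} (size : HasSize F q) where
  open Field F hiding (zero)
  open LinAlg F
  open LinearAlgebra F
  open HasSize size

  private
    variable
      ℓ' : Level
      k d : ℕ

  _≈?_ : ∀ x y → Dec (x ≈ y)
  x ≈? y with enum-surj x | enum-surj y
  ... | i , i≈x | j , j≈y with i ≟ j
  ... | yes ≡.refl = yes (trans (sym i≈x) j≈y)
  ... | no i≢j = no (λ x≈y → i≢j (enum-inj i j (trans i≈x (trans x≈y (sym j≈y)))))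

  ∃-Carrier? : {Q : Carrier → Set ℓ'} → (∀ {x y} → x ≈ y → Q x → Q y) → (∀ x → Dec (Q x)) → Dec (∃ Q)
  ∃-Carrier? resp Q? =
    map′ (λ { (i , Qi) → enum i , Qi })
         (λ { (x , Qx) → proj₁ (enum-surj x) , resp (sym (proj₂ (enum-surj x))) Qx })
         (Finₚ.any? (Q? ∘ enum))

  ∃-V? : {Q : V k → Set ℓ'} → (∀ {x y} → x ≈v y → Q x → Q y) → (∀ x → Dec (Q x)) → Dec (∃ Q)
  ∃-V? {k = zero} resp Q? = map′ (0v ,_) (λ { (x , Qx) → resp (λ ()) Qx }) (Q? 0v)
  ∃-V? {k = suc k} {Q = Q} resp Q? =
    map′ (λ { (x , xs , Qx∷xs) → x ∷ xs , Qx∷xs })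
         (λ { (xs , Qxs) → head xs , tail xs , resp (λ { zero → refl ; (suc i) → refl }) Qxs })
         (∃-Carrier? respHead (λ x → ∃-V? (respTail x) (λ xs → Q? (x ∷ xs))))
    where
    respTail : ∀ x {xs ys} → xs ≈v ys → Q (x ∷ xs) → Q (x ∷ ys)
    respTail x e = resp (λ { zero → refl ; (suc i) → e i })
    respHead : ∀ {x y} → x ≈ y → ∃ (λ xs → Q (x ∷ xs)) → ∃ (λ xs → Q (y ∷ xs))
    respHead e (xs , Q∷) = xs , resp (λ { zero → e ; (suc i) → refl }) Q∷

  InSpan? : (h : Fin d → V k) (a : V k) → Dec (InSpan h a)
  InSpan? h a =
    ∃-V? (λ e a≈ → ≈v-trans a≈ (linComb-congʳ h e)) (λ cs → Finₚ.all? (λ i → a i ≈? linComb h cs i))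

  LinIndep-∷ : ∀ {a : V k} {h : Fin d → V k} → LinIndep h → ¬ InSpan h a → LinIndep (a ∷ h)
  LinIndep-∷ {a = a} {h} h-indep a∉ cs z with head cs ≈? 0#
  ... | yes c₀≈0 = λ
    { zero    → c₀≈0
    ; (suc j) → h-indep (tail cs) (≈v-trans (≈v-sym (linComb-head-coeff≈0 (a ∷ h) cs c₀≈0)) z) j }
  ... | no c₀≉0 = ⊥-elim (a∉ ((- 1#) ·v (β ·v tail cs) , a≈))
    where
    β = proj₁ (inverse (head cs) c₀≉0)
    a+L≈0 : ∀ i → a i + linComb h (β ·v tail cs) i ≈ 0#
    a+L≈0 i = trans (sym (inverse-·v-linComb (a ∷ h) cs (proj₂ (inverse (head cs) c₀≉0)) i))
                    (trans (*-cong refl (z i)) (zeroʳ β))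
    a≈ : a ≈v linComb h ((- 1#) ·v (β ·v tail cs))
    a≈ i = trans (sym (x+y+[-1]y≈x (a i) _))
                 (trans (+-cong (a+L≈0 i) refl)
                        (trans (+-identityˡ _) (sym (linComb-·v h (- 1#) _ i))))

  UnionOfPts∩InSpan⊆InSpanOf : ∀ {P : V k → Set ℓ'} {x} (b : Fin d → V k) →
    UnionOfPts P x → InSpan b x → InSpanOf (λ v → P v × InSpan b v) x
  UnionOfPts∩InSpan⊆InSpanOf {P = P} {x} b (v , Pv , α , x≈αv) x∈ with α ≈? 0#
  ... | yes α≈0 = resp (λ i → sym (trans (x≈αv i) (trans (*-cong α≈0 refl) (zeroˡ _)))) 0v∈
    where open IsSubspace (InSpanOf-isSubspace (λ v → P v × InSpan b v))
  ... | no α≉0 = resp (≈v-sym x≈αv) (·v-closed α (InSpanOf-single _ (Pv , v∈)))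
    where
    open IsSubspace (InSpanOf-isSubspace (λ v → P v × InSpan b v))
    β = proj₁ (inverse α α≉0)
    v∈ : InSpan b v
    v∈ = IsSubspace.resp (InSpan-isSubspace b)
           (λ i → trans (*-cong refl (x≈αv i)) (inverse-cancel (proj₂ (inverse α α≉0)) (v i)))
           (IsSubspace.·v-closed (InSpan-isSubspace b) β x∈)

  module _ {k s d ℓ'} {P : V k → Set ℓ'} (blocking : StrongBlocking s P) (eq : d +ℕ suc s ≡.≡ k)
           {h : Fin d → V k} (h-indep : LinIndep h) (a : V k) where

    CosetPoint : Set (c ⊔ ℓ ⊔ ℓ')
    CosetPoint = ∃ λ x → UnionOfPts P x × ∃ λ ds → x ≈v (a +v linComb h ds)

    eq' : suc d +ℕ s ≡.≡ k
    eq' = ≡.trans (≡.sym (ℕₚ.+-suc d s)) eq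

    cosetPoint-inSpan : InSpan h a → CosetPoint
    cosetPoint-inSpan (cs , a≈) =
      0v , (v , Pv , 0# , λ i → sym (zeroˡ _)) , (- 1#) ·v cs ,
      λ i → sym (trans (+-cong (a≈ i) (linComb-·v h (- 1#) cs i)) (x+[-1]x≈0 _))
      where
      v : V k
      v = proj₁ (StrongBlocking-inhabited P d eq' blocking)
      Pv : P v
      Pv = proj₂ (StrongBlocking-inhabited P d eq' blocking)

    cosetPoint-scaled : ∀ {v} → P v → ∀ cs → v ≈v linComb (a ∷ h) cs → ¬ (head cs ≈ 0#) → CosetPoint
    cosetPoint-scaled {v} Pv cs v≈ c≉0 =
      β ·v v , (v , Pv , β , λ i → refl) , β ·v tail cs ,
      λ i → trans (*-cong refl (v≈ i)) (inverse-·v-linComb (a ∷ h) cs (proj₂ (inverse (head cs) c≉0)) i)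
      where β = proj₁ (inverse (head cs) c≉0)

    cosetPoint-fromExpansions : ∀ {m} (u : Fin m → V k) (coeff : Fin m → V (suc d)) →
      (∀ j → P (u j)) → (∀ j → u j ≈v linComb (a ∷ h) (coeff j)) → InSpan u a → ¬ InSpan h a → CosetPoint
    cosetPoint-fromExpansions u coeff Pu u≈ (λs , a≈) a∉ with Finₚ.all? (λ j → head (coeff j) ≈? 0#)
    ... | yes allZero = ⊥-elim (a∉ (resp (≈v-sym a≈) (linComb-closed u u∈span λs)))
      where
      open IsSubspace (InSpan-isSubspace h)
      u∈span : ∀ j → InSpan h (u j)
      u∈span j = tail (coeff j) , ≈v-trans (u≈ j) (linComb-head-coeff≈0 (a ∷ h) (coeff j) (allZero j))
    ... | no notAll with Finₚ.¬∀⟶∃¬ _ _ (λ j → head (coeff j) ≈? 0#) notAll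
    ... | j , c≉0 = cosetPoint-scaled (Pu j) (coeff j) (u≈ j) c≉0

    cosetPoint-outsideSpan : ¬ InSpan h a → CosetPoint
    cosetPoint-outsideSpan a∉
      with blocking (suc d) eq' (a ∷ h) (LinIndep-∷ h-indep a∉) a (InSpan-member (a ∷ h) zero)
    ... | m , u , u∈ , a∈ =
      cosetPoint-fromExpansions u (λ j → proj₁ (proj₂ (u∈ j))) (proj₁ ∘ u∈) (λ j → proj₂ (proj₂ (u∈ j))) a∈ a∉

    cosetPoint : CosetPoint
    cosetPoint with InSpan? h a
    ... | yes a∈ = cosetPoint-inSpan a∈
    ... | no a∉ = cosetPoint-outsideSpan a∉

  strongBlocking⇒affineBlocking : ∀ {k s ℓ'} {P : V k → Set ℓ'} →
    StrongBlocking s P → AffineBlocking (suc s) (UnionOfPts P)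
  strongBlocking⇒affineBlocking blocking d eq h h-indep a = cosetPoint blocking eq h-indep a

  affineBlocking⇒strongBlocking : ∀ {k s ℓ'} {P : V k → Set ℓ'} →
    AffineBlocking (suc s) (UnionOfPts P) → StrongBlocking s P
  affineBlocking⇒strongBlocking {s = s} {P = P} blocking d eq b b-indep x (cs , x≈) =
    IsSubspace.resp (InSpanOf-isSubspace S) (≈v-sym x≈) (affineBlocking-subspace⇒full U-subspace meets cs)
    where
    S : V _ → Set _
    S v = P v × InSpan b v

    U : V d → Set _
    U cs = InSpanOf S (linComb b cs)

    U-subspace : IsSubspace U
    U-subspace = IsSubspace-linComb⁻¹ b (InSpanOf-isSubspace S)

    meets : AffineBlocking 1 U
    meets d₁ eq₁ h h-indep a
      with blocking d₁ (≡.trans (≡.sym (ℕₚ.+-assoc d₁ 1 s)) (≡.trans (≡.cong (_+ℕ s) eq₁) eq))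
                    (λ j → linComb b (h j)) (LinIndep-linComb b-indep h-indep) (linComb b a)
    ... | y , y∈B , ds , y≈ =
      a +v linComb h ds ,
      IsSubspace.resp (InSpanOf-isSubspace S) y≈b (UnionOfPts∩InSpan⊆InSpanOf b y∈B (a +v linComb h ds , y≈b)) ,
      ds , λ i → refl
      where
      y≈b : y ≈v linComb b (a +v linComb h ds)
      y≈b i = trans (y≈ i) (trans (+-cong refl (sym (linComb-linComb b h ds i))) (sym (linComb-+v b a _ i)))

lemma1p2 : ∀ {c ℓ ℓ'} (F : Field c ℓ) (q : ℕ) → PrimePower q → HasSize F q →
    (k s : ℕ) → 1 ≤ s → (P : LinAlg.V F k → Set ℓ') → LinAlg.NonzeroPts F P →
    LinAlg.StrongBlocking F (s ∸ 1) P ⇔ LinAlg.AffineBlocking F s (LinAlg.UnionOfPts F P)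
lemma1p2 F _ _ size k (suc s) (s≤s z≤n) P _ = mk⇔ strongBlocking⇒affineBlocking affineBlocking⇒strongBlocking
  where open FiniteField F size
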